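{- Let $S$ be a set, $s_\bullet\in S$ fixed, and $s\in S$ with $s\ne s_\bullet$. For $n\ge1$, $$(\vert\veebar\mathbf 0_n,(s,s_\bullet,\dots,s_\bullet))=\sum_{j=1}^{n+1}(\mathbf 0_j,(s_\bullet,\dots,s_\bullet))\circ_1(M^{n+2-j},(s,s_\bullet,\dots,s_\bullet)),$$ where $(M^1,\emptyset):=\vert$, $(M^2,(s)):=(\vert\veebar\vert,(\hat s))$, and $(M^k,(s,s_\bullet,\dots,s_\bullet)):=(M_{\vert\veebar\mathbf 0_{k-1}},(s,s_\bullet,\dots,s_\bullet))$ for $k\ge3$.
   Context: Planar binary rooted trees: every internal vertex has two children; $\mathbf{PBT}_n$ = such trees with $n$ leaves, $\mathbf{PBT}_1=\{\vert\}$; internal vertices ordered left to right (the $i$-th lies between leaves $i$ and $i+1$). A colored tree $(t,(s_1,\dots,s_{n-1}))$ has $t\in\mathbf{PBT}_n$ and $s_i\in S$ the color of the $i$-th internal vertex; for colors in $\mathbb K[S]$ one expands multilinearly, and $\hat s:=s-s_\bullet$. $t\veebar w$ joins the roots of $t$ (left), $w$ (right) to a new root; $\mathbf 0_1=\vert$, $\mathbf 0_j=\mathbf 0_{j-1}\veebar\vert$. Grafting at the first leaf: $(t,(s_1..s_{n-1}))\circ_1(w,(r_1..r_{m-1}))=(t\circ_1w,(r_1,\dots,r_{m-1},s_1,\dots,s_{n-1}))$, where $t\circ_1w$ identifies the root of $w$ with the leftmost leaf of $t$; extended multilinearly. Colors tuples have length equal to (number of leaves $-1$). Tamari order $\le_T$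 on $\mathbf{PBT}_k$: generated by $(t_1\veebar t_2)\veebar t_3\le_Tt_1\veebar(t_2\veebar t_3)$ and compatibility with $\veebar$; $(M_t,(s_\cdot))=\sum_{w\le_Tt}\mu(w,t)(w,(s_\cdot))$, $\mu$ the Möbius function. -}

module Defs where

open import Data.Nat using (ℕ; zero; suc; _∸_; _+_)
open import Data.Integer using (ℤ; _*_; -_) renaming (_+_ to _+ℤ_)
open import Data.Integer using (0ℤ; 1ℤ)
open import Data.List using (List; []; _∷_; [_]; _++_; map; concatMap; upTo; replicate; length; foldr)
open import Data.Product using (_×_; _,_)
open import Relation.Nullary using (Dec; yes; no; does)
open import Relation.Binary using (Decidable)
open import Relation.Binary.PropositionalEquality using (_≡_; refl)
open import Data.Bool using (Bool; true; false; if_then_else_)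

-- Planar binary rooted trees (leaf = |, node t w = t ∨ w)

data Tree : Set where
  leaf : Tree
  node : Tree → Tree → Tree

leaves : Tree → ℕ
leaves leaf       = 1
leaves (node t w) = leaves t + leaves w

eqT : Tree → Tree → Bool
eqT leaf       leaf         = true
eqT leaf       (node _ _)   = false
eqT (node _ _) leaf         = false
eqT (node a b) (node c d)   = if eqT a c then eqT b d else false

-- gen f m : all trees with m internal vertices (fuel f ≥ m)
gen : ℕ → ℕ → List Tree
gen _       zero    = [ leaf ]
gen zero    (suc m) = []
gen (suc f) (suc m) =
  concatMap (λ i → concatMap (λ l → map (node l) (gen f (m ∸ i))) (gen f i)) (upTo (suc m))

PBT : ℕ → List Tree
PBT zero    = []
PBT (suc m) = gen m m

-- 0_j  (left comb with j leaves); O 0 is junk (= leaf), never used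
O : ℕ → Tree
O zero                = leaf
O (suc zero)          = leaf
O (suc (suc j))       = node (O (suc j)) leaf

graft1 : Tree → Tree → Tree
graft1 leaf       w = w
graft1 (node l r) w = node (graft1 l w) r

data _≤T_ : Tree → Tree → Set where
  rot   : ∀ a b c → node (node a b) c ≤T node a (node b c)
  ≤refl : ∀ t → t ≤T t
  ≤trans : ∀ {a b c} → a ≤T b → b ≤T c → a ≤T c
  congˡ : ∀ {a a'} b → a ≤T a' → node a b ≤T node a' b
  congʳ : ∀ a {b b'} → b ≤T b' → node a b ≤T node a b'

module _ (S : Set) where

  CT : Set
  CT = Tree × List S

  Lin : Set
  Lin = List (ℤ × CT)

  ⟦_⟧ : Lin → (CT → ℤ) → ℤ
  ⟦ L ⟧ f = foldr (λ { (c , x) acc → c * f x +ℤ acc }) 0ℤ L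

  -- equality in the free ℤ-module on colored trees
  _≋_ : Lin → Lin → Set
  L ≋ R = ∀ (f : CT → ℤ) → ⟦ L ⟧ f ≡ ⟦ R ⟧ f

  graftCT : CT → CT → CT
  graftCT (t , ss) (w , rs) = (graft1 t w , rs ++ ss)

  _∘₁_ : Lin → Lin → Lin
  L ∘₁ R = concatMap (λ { (a , x) → map (λ { (b , y) → (a * b , graftCT x y) }) R }) L

ζ : Decidable _≤T_ → Tree → Tree → ℤ
ζ dec w u = if does (dec w u) then 1ℤ else 0ℤ

δ : Tree → Tree → ℤ
δ w t = if eqT w t then 1ℤ else 0ℤ

sumℤ : List ℤ → ℤ
sumℤ = foldr _+ℤ_ 0ℤ

IsMobius : Decidable _≤T_ → (Tree → Tree → ℤ) → Set
IsMobius dec μ = ∀ w t → leaves w ≡ leaves t →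
  sumℤ (map (λ u → ζ dec w u * μ u t) (PBT (leaves t))) ≡ δ w t

module _ {S : Set} where

  Mt : (Tree → Tree → ℤ) → Tree → List S → Lin S
  Mt μ t cols = map (λ w → (μ w t , (w , cols))) (PBT (leaves t))

  Mk : (Tree → Tree → ℤ) → (s• s : S) → ℕ → Lin S
  Mk μ s• s zero                  = []   -- junk, never used
  Mk μ s• s (suc zero)            = [ (1ℤ , (leaf , [])) ]
  Mk μ s• s (suc (suc zero))      =
    (1ℤ , (node leaf leaf , [ s ])) ∷ (- 1ℤ , (node leaf leaf , [ s• ])) ∷ []
  Mk μ s• s (suc (suc (suc m)))   =
    Mt μ (node leaf (O (suc (suc m)))) (s ∷ replicate (suc m) s•)

  LHS : (s• s : S) → ℕ → Lin S
  LHS s• s n = [ (1ℤ , (node leaf (O n) , s ∷ replicate (n ∸ 1) s•)) ]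

  RHS : (Tree → Tree → ℤ) → (s• s : S) → ℕ → Lin S
  RHS μ s• s n =
    concatMap (λ j' → _∘₁_ S [ (1ℤ , (O (suc j') , replicate j' s•)) ] (Mk μ s• s (suc n ∸ j')))
              (upTo (suc n))

-- The tree t = | ∨ 0_k (k ≥ 2) covers exactly one tree in the Tamari order, namely
-- c = (| ∨ 0_{k-1}) ∨ |, and everything strictly below t lies below c.  Since the
-- zeta matrix is unitriangular, the column μ(·, t) is the unique solution of
-- ζ · x = δ_t, and δ_t − δ_c is one; hence (M_t, cols) = (t, cols) − (c, cols).
-- Grafting onto 0_j, the j-th summand on the right becomes the difference of the
-- colored trees 0_j ∘₁ (| ∨ 0_{n+1-j}) and 0_{j+1} ∘₁ (| ∨ 0_{n-j}), the last two
-- summands (from M² and M¹) add up to 0_n ∘₁ (| ∨ |), and the sum telescopes to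
-- | ∨ 0_n.
module Submission where

open import Defs
open import Data.Nat using (ℕ; zero; suc; _≤_; _<_; _+_; _∸_; z≤n; s≤s)
import Data.Nat.Properties as ℕ
open import Data.Nat.Induction using (<-wellFounded)
open import Data.Nat.Tactic.RingSolver using () renaming (solve-∀ to solve-∀ℕ)
open import Data.Integer using (ℤ; 0ℤ; 1ℤ; -_)
  renaming (_+_ to _+ℤ_; _*_ to _*ℤ_; _-_ to _-ℤ_)
import Data.Integer.Properties as ℤ
open import Algebra.Properties.Ring ℤ.+-*-ring using (x[y-z]≈xy-xz; [y-z]x≈yx-zx)
open import Data.Integer.Tactic.RingSolver using (solve-∀)
open import Data.List using (List; []; _∷_; _++_; map; concatMap; upTo; replicate)
import Data.List.Properties as List
open import Data.List.Relation.Unary.All as All using (All; []; _∷_)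
import Data.List.Relation.Unary.All.Properties as All
open import Data.Bool using (true; false)
open import Data.Sum using (_⊎_; inj₁; inj₂; [_,_]; fromInj₂)
open import Data.Product using (_,_)
open import Function using (_∘_; id)
open import Relation.Nullary using (¬_; Dec; yes; no; contradiction)
open import Relation.Binary using (Decidable; DecidableEquality)
open import Relation.Binary.PropositionalEquality hiding ([_])
open import Relation.Binary.Construct.On as On using ()
import Induction.WellFounded as WF
open ≡-Reasoning

private
  variable
    a b c t u w : Tree

internal : Tree → ℕ
internal leaf       = 0
internal (node l r) = suc (internal l + internal r)

leaves≡suc-internal : ∀ t → leaves t ≡ suc (internal t)
leaves≡suc-internal leaf       = refl
leaves≡suc-internal (node l r)
  rewrite leaves≡suc-internal l | leaves≡suc-internal r =
  cong suc (ℕ.+-suc (internal l) (internal r))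

0<leaves : ∀ t → 0 < leaves t
0<leaves t rewrite leaves≡suc-internal t = s≤s z≤n

eqT-refl : ∀ t → eqT t t ≡ true
eqT-refl leaf       = refl
eqT-refl (node l r) rewrite eqT-refl l = eqT-refl r

eqT⇒≡ : ∀ a b → eqT a b ≡ true → a ≡ b
eqT⇒≡ leaf       leaf         _  = refl
eqT⇒≡ (node l r) (node l′ r′) eq with eqT l l′ in l≡l′
eqT⇒≡ (node l r) (node l′ r′) eq | true = cong₂ node (eqT⇒≡ l l′ l≡l′) (eqT⇒≡ r r′ eq)
eqT⇒≡ (node l r) (node l′ r′) () | false

_≟T_ : DecidableEquality Tree
a ≟T b with eqT a b in eq
... | true  = yes (eqT⇒≡ a b eq)
... | false = no λ { refl → contradiction (trans (sym (eqT-refl a)) eq) λ () }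

graft-O : ∀ j w → graft1 (O (suc j)) (node w leaf) ≡ graft1 (O (suc (suc j))) w
graft-O zero    w = refl
graft-O (suc j) w = cong (λ v → node v leaf) (graft-O j w)

-- The Tamari order

≤T-leaves : a ≤T b → leaves a ≡ leaves b
≤T-leaves (rot a b c)  = ℕ.+-assoc (leaves a) (leaves b) (leaves c)
≤T-leaves (≤refl t)    = refl
≤T-leaves (≤trans p q) = trans (≤T-leaves p) (≤T-leaves q)
≤T-leaves (congˡ b p)  = cong (_+ leaves b) (≤T-leaves p)
≤T-leaves (congʳ a p)  = cong (leaves a +_) (≤T-leaves p)

-- The rotation (a ∨ b) ∨ c ≤T a ∨ (b ∨ c) lowers the weight by leaves a > 0.
weight : Tree → ℕ
weight leaf       = 0
weight (node l r) = weight l + weight r + leaves l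

≤T-weight : a ≤T b → a ≡ b ⊎ weight b < weight a
≤T-weight (rot a b c) = inj₂ (ℕ.<-≤-trans (ℕ.m<m+n _ (0<leaves a))
  (ℕ.≤-reflexive (rotation (weight a) (weight b) (weight c) (leaves a) (leaves b))))
  where
  rotation : ∀ A B C La Lb → A + (B + C + Lb) + La + La ≡ A + B + La + C + (La + Lb)
  rotation = solve-∀ℕ
≤T-weight (≤refl t) = inj₁ refl
≤T-weight (≤trans p q) with ≤T-weight p | ≤T-weight q
... | inj₁ refl | q′        = q′
... | inj₂ p′   | inj₁ refl = inj₂ p′
... | inj₂ p′   | inj₂ q′   = inj₂ (ℕ.<-trans q′ p′)
≤T-weight (congˡ b p) with ≤T-weight p
... | inj₁ refl = inj₁ refl
... | inj₂ p′ rewrite ≤T-leaves p = inj₂ (ℕ.+-monoˡ-< _ (ℕ.+-monoˡ-< (weight b) p′))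
≤T-weight (congʳ a p) with ≤T-weight p
... | inj₁ refl = inj₁ refl
... | inj₂ p′   = inj₂ (ℕ.+-monoˡ-< (leaves a) (ℕ.+-monoʳ-< (weight a) p′))

≤T-antisym : a ≤T b → b ≤T a → a ≡ b
≤T-antisym p q with ≤T-weight p | ≤T-weight q
... | inj₁ a≡b | _        = a≡b
... | inj₂ _   | inj₁ b≡a = sym b≡a
... | inj₂ p′  | inj₂ q′  = contradiction p′ (ℕ.<-asym q′)

data IsLeftComb : Tree → Set where
  leaf : IsLeftComb leaf
  node : IsLeftComb t → IsLeftComb (node t leaf)

O-isLeftComb : ∀ j → IsLeftComb (O j)
O-isLeftComb zero          = leaf
O-isLeftComb (suc zero)    = leaf
O-isLeftComb (suc (suc j)) = node (O-isLeftComb (suc j))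

leftComb-minimal : a ≤T b → IsLeftComb b → a ≡ b
leftComb-minimal (≤refl t)    _        = refl
leftComb-minimal (≤trans p q) comb with leftComb-minimal q comb
... | refl = leftComb-minimal p comb
leftComb-minimal (congˡ b p)  (node comb) = cong (λ l → node l leaf) (leftComb-minimal p comb)
leftComb-minimal (congʳ a p)  (node comb) = cong (node a) (leftComb-minimal p leaf)

record UniqueLowerCover (c t : Tree) : Set where
  field
    c≤t     : c ≤T t
    c≢t     : c ≢ t
    below-t : u ≤T t → u ≡ t ⊎ u ≤T c

leftComb-rotation-cover : IsLeftComb a → IsLeftComb b →
                          UniqueLowerCover (node (node a b) leaf) (node a (node b leaf))
leftComb-rotation-cover {a} {b} combA combB = record
  { c≤t = rot a b leaf ; c≢t = λ () ; below-t = below }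
  where
  below : u ≤T node a (node b leaf) → u ≡ node a (node b leaf) ⊎ u ≤T node (node a b) leaf
  below (rot _ _ _)  = inj₂ (≤refl _)
  below (≤refl _)    = inj₁ refl
  below (≤trans p q) with below q
  ... | inj₁ refl = below p
  ... | inj₂ q′   = inj₂ (≤trans p q′)
  below (congˡ _ p) rewrite leftComb-minimal p combA        = inj₁ refl
  below (congʳ _ p) rewrite leftComb-minimal p (node combB) = inj₁ refl

∑ : {A : Set} → List A → (A → ℤ) → ℤ
∑ xs F = sumℤ (map F xs)

module _ {A : Set} {F G : A → ℤ} where

  ∑-cong : ∀ xs → (∀ x → F x ≡ G x) → ∑ xs F ≡ ∑ xs G
  ∑-cong xs F≗G = cong sumℤ (List.map-cong F≗G xs)

  ∑-cong-All : ∀ {xs} → All (λ x → F x ≡ G x) xs → ∑ xs F ≡ ∑ xs G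
  ∑-cong-All = cong sumℤ ∘ List.map-cong-local

  ∑-− : ∀ xs → ∑ xs (λ x → F x -ℤ G x) ≡ ∑ xs F -ℤ ∑ xs G
  ∑-− []       = refl
  ∑-− (x ∷ xs) rewrite ∑-− xs = interchange (F x) (G x) (∑ xs F) (∑ xs G)
    where
    interchange : ∀ p q r s → (p -ℤ q) +ℤ (r -ℤ s) ≡ (p +ℤ r) -ℤ (q +ℤ s)
    interchange = solve-∀

module _ {A : Set} {F : A → ℤ} where

  ∑-zero : ∀ {xs} → All (λ x → F x ≡ 0ℤ) xs → ∑ xs F ≡ 0ℤ
  ∑-zero []         = refl
  ∑-zero (px ∷ pxs) = cong₂ _+ℤ_ px (∑-zero pxs)

  ∑-++ : ∀ xs ys → ∑ (xs ++ ys) F ≡ ∑ xs F +ℤ ∑ ys F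
  ∑-++ []       ys = sym (ℤ.+-identityˡ _)
  ∑-++ (x ∷ xs) ys rewrite ∑-++ xs ys = sym (ℤ.+-assoc (F x) _ _)

  ∑-concatMap : ∀ {B : Set} (G : B → List A) xs → ∑ (concatMap G xs) F ≡ ∑ xs (λ x → ∑ (G x) F)
  ∑-concatMap G []       = refl
  ∑-concatMap G (x ∷ xs) = trans (∑-++ (G x) _) (cong (∑ (G x) F +ℤ_) (∑-concatMap G xs))

  ∑-map : ∀ {B : Set} (φ : B → A) xs → ∑ (map φ xs) F ≡ ∑ xs (F ∘ φ)
  ∑-map φ xs = cong sumℤ (sym (List.map-∘ xs))

  ∑-*ˡ : ∀ k xs → ∑ xs (λ x → k *ℤ F x) ≡ k *ℤ ∑ xs F
  ∑-*ˡ k []       = sym (ℤ.*-zeroʳ k)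
  ∑-*ˡ k (x ∷ xs) rewrite ∑-*ˡ k xs = sym (ℤ.*-distribˡ-+ k (F x) (∑ xs F))

  ∑-*ʳ : ∀ k xs → ∑ xs (λ x → F x *ℤ k) ≡ ∑ xs F *ℤ k
  ∑-*ʳ k []       = sym (ℤ.*-zeroˡ k)
  ∑-*ʳ k (x ∷ xs) rewrite ∑-*ʳ k xs = sym (ℤ.*-distribʳ-+ k (F x) (∑ xs F))

∑-upTo-suc : ∀ n (F : ℕ → ℤ) → ∑ (upTo (suc n)) F ≡ F 0 +ℤ ∑ (upTo n) (F ∘ suc)
∑-upTo-suc n F = cong (λ xs → F 0 +ℤ sumℤ xs)
  (trans (List.map-applyUpTo suc F n) (sym (List.map-upTo (F ∘ suc) n)))

∑-upTo-single : ∀ {n k} (F : ℕ → ℤ) → k < n → (∀ i → i ≢ k → F i ≡ 0ℤ) → ∑ (upTo n) F ≡ F k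
∑-upTo-single {suc n} {zero} F _ F≡0 = begin
    ∑ (upTo (suc n)) F                 ≡⟨ ∑-upTo-suc n F ⟩
    F 0 +ℤ ∑ (upTo n) (F ∘ suc)        ≡⟨ cong (F 0 +ℤ_) (∑-zero (tail≡0 n)) ⟩
    F 0 +ℤ 0ℤ                          ≡⟨ ℤ.+-identityʳ (F 0) ⟩
    F 0                                ∎
  where
  tail≡0 : ∀ m → All (λ i → F (suc i) ≡ 0ℤ) (upTo m)
  tail≡0 m = All.applyUpTo⁺₂ id m (λ i → F≡0 (suc i) λ ())
∑-upTo-single {suc n} {suc k} F (s≤s k<n) F≡0 = begin
    ∑ (upTo (suc n)) F                 ≡⟨ ∑-upTo-suc n F ⟩
    F 0 +ℤ ∑ (upTo n) (F ∘ suc)        ≡⟨ cong (_+ℤ ∑ (upTo n) (F ∘ suc)) (F≡0 0 λ ()) ⟩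
    0ℤ +ℤ ∑ (upTo n) (F ∘ suc)         ≡⟨ ℤ.+-identityˡ _ ⟩
    ∑ (upTo n) (F ∘ suc)               ≡⟨ ∑-upTo-single (F ∘ suc) k<n (λ i i≢k → F≡0 (suc i) (i≢k ∘ ℕ.suc-injective)) ⟩
    F (suc k)                          ∎

telescope : ∀ p (F h : ℕ → ℤ) → (∀ {j} → j < p → F j ≡ h j -ℤ h (suc j)) →
            F p +ℤ F (suc p) ≡ h p → ∑ (upTo (2 + p)) F ≡ h 0
telescope zero    F h _    last = trans (cong (F 0 +ℤ_) (ℤ.+-identityʳ (F 1))) last
telescope (suc p) F h step last = begin
    ∑ (upTo (3 + p)) F                 ≡⟨ ∑-upTo-suc (2 + p) F ⟩
    F 0 +ℤ ∑ (upTo (2 + p)) (F ∘ suc)  ≡⟨ cong (F 0 +ℤ_) (telescope p (F ∘ suc) (h ∘ suc) (step ∘ s≤s) last) ⟩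
    F 0 +ℤ h 1                         ≡⟨ cong (_+ℤ h 1) (step (s≤s z≤n)) ⟩
    (h 0 -ℤ h 1) +ℤ h 1                ≡⟨ cancel (h 0) (h 1) ⟩
    h 0                                ∎
  where
  cancel : ∀ x y → (x -ℤ y) +ℤ y ≡ x
  cancel = solve-∀

-- Enumerating PBT

δ-refl : ∀ t → δ t t ≡ 1ℤ
δ-refl t rewrite eqT-refl t = refl

δ-≢ : a ≢ b → δ a b ≡ 0ℤ
δ-≢ {a} {b} a≢b with eqT a b in eq
... | true  = contradiction (eqT⇒≡ a b eq) a≢b
... | false = refl

δ-node : ∀ l r a b → δ (node l r) (node a b) ≡ δ l a *ℤ δ r b
δ-node l r a b with eqT l a | eqT r b
... | true  | true  = refl
... | true  | false = refl
... | false | true  = refl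
... | false | false = refl

δ-* : ∀ u a (h : Tree → ℤ) → δ u a *ℤ h u ≡ δ u a *ℤ h a
δ-* u a h with u ≟T a
... | yes refl = refl
... | no u≢a rewrite δ-≢ u≢a = trans (ℤ.*-zeroˡ (h u)) (sym (ℤ.*-zeroˡ (h a)))

occurrences : Tree → List Tree → ℤ
occurrences a xs = ∑ xs (λ u → δ u a)

occurrences-absent : ∀ {xs} → All (_≢ a) xs → occurrences a xs ≡ 0ℤ
occurrences-absent = ∑-zero ∘ All.map δ-≢

occurrences-product : ∀ a b Ls Rs →
  occurrences (node a b) (concatMap (λ l → map (node l) Rs) Ls) ≡ occurrences a Ls *ℤ occurrences b Rs
occurrences-product a b Ls Rs = begin
    ∑ (concatMap (λ l → map (node l) Rs) Ls) (λ u → δ u (node a b))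
  ≡⟨ ∑-concatMap (λ l → map (node l) Rs) Ls ⟩
    ∑ Ls (λ l → ∑ (map (node l) Rs) (λ u → δ u (node a b)))
  ≡⟨ ∑-cong Ls (λ l → trans (∑-map (node l) Rs) (∑-cong Rs (λ r → δ-node l r a b))) ⟩
    ∑ Ls (λ l → ∑ Rs (λ r → δ l a *ℤ δ r b))
  ≡⟨ ∑-cong Ls (λ l → ∑-*ˡ (δ l a) Rs) ⟩
    ∑ Ls (λ l → δ l a *ℤ occurrences b Rs)
  ≡⟨ ∑-*ʳ (occurrences b Rs) Ls ⟩
    occurrences a Ls *ℤ occurrences b Rs
  ∎

gen-internal : ∀ f m → All (λ u → internal u ≡ m) (gen f m)
gen-internal zero    zero    = refl ∷ []
gen-internal (suc f) zero    = refl ∷ []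
gen-internal zero    (suc m) = []
gen-internal (suc f) (suc m) =
  All.concat⁺ (All.map⁺ (All.applyUpTo⁺₁ id (suc m) λ {i} i≤m →
    All.concat⁺ (All.map⁺ (All.map (λ l≡i →
      All.map⁺ (All.map (λ r≡m∸i → cong suc (trans (cong₂ _+_ l≡i r≡m∸i) (ℕ.m+[n∸m]≡n (ℕ.≤-pred i≤m))))
        (gen-internal f (m ∸ i))))
      (gen-internal f i)))))

gen-once : ∀ f a → internal a ≤ f → occurrences a (gen f (internal a)) ≡ 1ℤ
gen-once zero    leaf         _ = refl
gen-once (suc f) leaf         _ = refl
gen-once (suc f) (node a₁ a₂) (s≤s m≤f) = begin
    occurrences (node a₁ a₂) (concatMap slice (upTo (suc m)))
  ≡⟨ ∑-concatMap slice (upTo (suc m)) ⟩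
    ∑ (upTo (suc m)) (λ i → occurrences (node a₁ a₂) (slice i))
  ≡⟨ ∑-cong (upTo (suc m)) (λ i → occurrences-product a₁ a₂ (gen f i) (gen f (m ∸ i))) ⟩
    ∑ (upTo (suc m)) (λ i → occurrences a₁ (gen f i) *ℤ occurrences a₂ (gen f (m ∸ i)))
  ≡⟨ ∑-upTo-single _ (s≤s (ℕ.m≤m+n (internal a₁) (internal a₂))) other-sizes ⟩
    occurrences a₁ (gen f (internal a₁)) *ℤ occurrences a₂ (gen f (m ∸ internal a₁))
  ≡⟨ cong₂ _*ℤ_ (gen-once f a₁ (ℕ.m+n≤o⇒m≤o _ m≤f))
                (trans (cong (λ k → occurrences a₂ (gen f k)) (ℕ.m+n∸m≡n (internal a₁) (internal a₂)))
                       (gen-once f a₂ (ℕ.m+n≤o⇒n≤o (internal a₁) m≤f))) ⟩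
    1ℤ
  ∎
  where
  m : ℕ
  m = internal a₁ + internal a₂
  slice : ℕ → List Tree
  slice i = concatMap (λ l → map (node l) (gen f (m ∸ i))) (gen f i)
  other-sizes : ∀ i → i ≢ internal a₁ →
                occurrences a₁ (gen f i) *ℤ occurrences a₂ (gen f (m ∸ i)) ≡ 0ℤ
  other-sizes i i≢ rewrite occurrences-absent {a₁} (All.map (λ l≡i l≡a₁ → i≢ (trans (sym l≡i) (cong internal l≡a₁)))
                                                            (gen-internal f i))
    = ℤ.*-zeroˡ (occurrences a₂ (gen f (m ∸ i)))

PBT-leaves : ∀ L → All (λ u → leaves u ≡ L) (PBT L)
PBT-leaves zero    = []
PBT-leaves (suc m) = All.map (λ {u} u≡m → trans (leaves≡suc-internal u) (cong suc u≡m)) (gen-internal m m)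

PBT-once : ∀ a → occurrences a (PBT (leaves a)) ≡ 1ℤ
PBT-once a rewrite leaves≡suc-internal a = gen-once (internal a) a ℕ.≤-refl

PBT-δ : ∀ {L a} (h : Tree → ℤ) → leaves a ≡ L → ∑ (PBT L) (λ u → δ u a *ℤ h u) ≡ h a
PBT-δ {a = a} h refl = begin
    ∑ (PBT (leaves a)) (λ u → δ u a *ℤ h u)  ≡⟨ ∑-cong (PBT (leaves a)) (λ u → δ-* u a h) ⟩
    ∑ (PBT (leaves a)) (λ u → δ u a *ℤ h a)  ≡⟨ ∑-*ʳ (h a) (PBT (leaves a)) ⟩
    occurrences a (PBT (leaves a)) *ℤ h a    ≡⟨ cong (_*ℤ h a) (PBT-once a) ⟩
    1ℤ *ℤ h a                                ≡⟨ ℤ.*-identityˡ (h a) ⟩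
    h a                                      ∎

-- The Möbius function

module _ (dec : Decidable _≤T_) where

  ζ-≤ : w ≤T u → ζ dec w u ≡ 1ℤ
  ζ-≤ {w} {u} w≤u with dec w u
  ... | yes _   = refl
  ... | no w≰u = contradiction w≤u w≰u

  ζ-≰ : ¬ w ≤T u → ζ dec w u ≡ 0ℤ
  ζ-≰ {w} {u} w≰u with dec w u
  ... | yes w≤u = contradiction w≤u w≰u
  ... | no _    = refl

  -- ζ is unitriangular with respect to the weight.
  ζ-kernel : ∀ L (d : Tree → ℤ) →
             (∀ w → leaves w ≡ L → ∑ (PBT L) (λ u → ζ dec w u *ℤ d u) ≡ 0ℤ) →
             ∀ w → leaves w ≡ L → d w ≡ 0ℤ
  ζ-kernel L d ζd≡0 = WF.All.wfRec (On.wellFounded weight <-wellFounded) _ _ step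
    where
    step : ∀ w → (∀ {u} → weight u < weight w → leaves u ≡ L → d u ≡ 0ℤ) → leaves w ≡ L → d w ≡ 0ℤ
    step w ih w∈L = begin
        d w                                  ≡⟨ PBT-δ d w∈L ⟨
        ∑ (PBT L) (λ u → δ u w *ℤ d u)       ≡⟨ ∑-cong-All (All.map diagonal (PBT-leaves L)) ⟨
        ∑ (PBT L) (λ u → ζ dec w u *ℤ d u)   ≡⟨ ζd≡0 w w∈L ⟩
        0ℤ                                   ∎
      where
      off-diagonal : u ≢ w → leaves u ≡ L → Dec (w ≤T u) → ζ dec w u *ℤ d u ≡ 0ℤ
      off-diagonal {u} u≢w u∈L (yes w≤u) =
        trans (cong (ζ dec w u *ℤ_) (ih (fromInj₂ (λ w≡u → contradiction (sym w≡u) u≢w) (≤T-weight w≤u)) u∈L))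
              (ℤ.*-zeroʳ (ζ dec w u))
      off-diagonal {u} u≢w u∈L (no w≰u)  = trans (cong (_*ℤ d u) (ζ-≰ w≰u)) (ℤ.*-zeroˡ (d u))
      diagonal : leaves u ≡ L → ζ dec w u *ℤ d u ≡ δ u w *ℤ d u
      diagonal {u} u∈L with u ≟T w
      ... | yes refl = cong (_*ℤ d w) (trans (ζ-≤ (≤refl w)) (sym (δ-refl w)))
      ... | no u≢w   = begin
        ζ dec w u *ℤ d u   ≡⟨ off-diagonal u≢w u∈L (dec w u) ⟩
        0ℤ                 ≡⟨ ℤ.*-zeroˡ (d u) ⟨
        0ℤ *ℤ d u          ≡⟨ cong (_*ℤ d u) (δ-≢ u≢w) ⟨
        δ u w *ℤ d u       ∎

module _ (dec : Decidable _≤T_) (μ : Tree → Tree → ℤ) (isMobius : IsMobius dec μ) where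

  μ-unique : ∀ t (ν : Tree → ℤ) →
             (∀ w → leaves w ≡ leaves t → ∑ (PBT (leaves t)) (λ u → ζ dec w u *ℤ ν u) ≡ δ w t) →
             ∀ w → leaves w ≡ leaves t → μ w t ≡ ν w
  μ-unique t ν ζν≡δ w w∈L = ℤ.i-j≡0⇒i≡j _ _ (ζ-kernel dec (leaves t) (λ u → μ u t -ℤ ν u) ζd≡0 w w∈L)
    where
    ζd≡0 : ∀ w → leaves w ≡ leaves t → ∑ (PBT (leaves t)) (λ u → ζ dec w u *ℤ (μ u t -ℤ ν u)) ≡ 0ℤ
    ζd≡0 w w∈L = begin
        ∑ (PBT (leaves t)) (λ u → ζ dec w u *ℤ (μ u t -ℤ ν u))
      ≡⟨ ∑-cong (PBT (leaves t)) (λ u → x[y-z]≈xy-xz (ζ dec w u) (μ u t) (ν u)) ⟩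
        ∑ (PBT (leaves t)) (λ u → ζ dec w u *ℤ μ u t -ℤ ζ dec w u *ℤ ν u)
      ≡⟨ ∑-− (PBT (leaves t)) ⟩
        ∑ (PBT (leaves t)) (λ u → ζ dec w u *ℤ μ u t) -ℤ ∑ (PBT (leaves t)) (λ u → ζ dec w u *ℤ ν u)
      ≡⟨ cong₂ _-ℤ_ (isMobius w t w∈L) (ζν≡δ w w∈L) ⟩
        δ w t -ℤ δ w t
      ≡⟨ ℤ.+-inverseʳ (δ w t) ⟩
        0ℤ
      ∎

  μ-uniqueLowerCover : UniqueLowerCover c t → ∀ w → leaves w ≡ leaves t → μ w t ≡ δ w t -ℤ δ w c
  μ-uniqueLowerCover {c} {t} cover = μ-unique t (λ u → δ u t -ℤ δ u c) ζν≡δ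
    where
    open UniqueLowerCover cover
    distrib : ∀ z x y → z *ℤ (x -ℤ y) ≡ x *ℤ z -ℤ y *ℤ z
    distrib = solve-∀
    interval : ∀ w → ζ dec w t -ℤ ζ dec w c ≡ δ w t
    interval w with w ≟T t
    ... | yes refl rewrite ζ-≤ dec (≤refl t) | ζ-≰ dec (c≢t ∘ ≤T-antisym c≤t) = sym (δ-refl t)
    ... | no w≢t with dec w c
    ...   | yes w≤c rewrite ζ-≤ dec (≤trans w≤c c≤t) | δ-≢ w≢t = refl
    ...   | no w≰c  rewrite ζ-≰ dec ([ w≢t , w≰c ] ∘ below-t) | δ-≢ w≢t = refl
    ζν≡δ : ∀ w → leaves w ≡ leaves t → ∑ (PBT (leaves t)) (λ u → ζ dec w u *ℤ (δ u t -ℤ δ u c)) ≡ δ w t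
    ζν≡δ w _ = begin
        ∑ (PBT (leaves t)) (λ u → ζ dec w u *ℤ (δ u t -ℤ δ u c))
      ≡⟨ ∑-cong (PBT (leaves t)) (λ u → distrib (ζ dec w u) (δ u t) (δ u c)) ⟩
        ∑ (PBT (leaves t)) (λ u → δ u t *ℤ ζ dec w u -ℤ δ u c *ℤ ζ dec w u)
      ≡⟨ ∑-− (PBT (leaves t)) ⟩
        ∑ (PBT (leaves t)) (λ u → δ u t *ℤ ζ dec w u) -ℤ ∑ (PBT (leaves t)) (λ u → δ u c *ℤ ζ dec w u)
      ≡⟨ cong₂ _-ℤ_ (PBT-δ (ζ dec w) refl) (PBT-δ (ζ dec w) (≤T-leaves c≤t)) ⟩
        ζ dec w t -ℤ ζ dec w c
      ≡⟨ interval w ⟩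
        δ w t
      ∎

module _ {S : Set} where

  ⟦singleton⟧ : ∀ x f → ⟦_⟧ S ((1ℤ , x) ∷ []) f ≡ f x
  ⟦singleton⟧ x f = trans (ℤ.+-identityʳ _) (ℤ.*-identityˡ (f x))

  ⟦difference⟧ : ∀ x y f → ⟦_⟧ S ((1ℤ , x) ∷ (- 1ℤ , y) ∷ []) f ≡ f x -ℤ f y
  ⟦difference⟧ x y f = unit-coefficients (f x) (f y)
    where
    unit-coefficients : ∀ p q → 1ℤ *ℤ p +ℤ (- 1ℤ *ℤ q +ℤ 0ℤ) ≡ p -ℤ q
    unit-coefficients = solve-∀

  ⟦++⟧ : ∀ (A B : Lin S) f → ⟦_⟧ S (A ++ B) f ≡ ⟦_⟧ S A f +ℤ ⟦_⟧ S B f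
  ⟦++⟧ []            B f = sym (ℤ.+-identityˡ _)
  ⟦++⟧ ((k , x) ∷ A) B f =
    trans (cong (k *ℤ f x +ℤ_) (⟦++⟧ A B f)) (sym (ℤ.+-assoc (k *ℤ f x) (⟦_⟧ S A f) (⟦_⟧ S B f)))

  ⟦concatMap⟧ : ∀ {A : Set} (G : A → Lin S) xs f → ⟦_⟧ S (concatMap G xs) f ≡ ∑ xs (λ x → ⟦_⟧ S (G x) f)
  ⟦concatMap⟧ G []       f = refl
  ⟦concatMap⟧ G (x ∷ xs) f = trans (⟦++⟧ (G x) _ f) (cong (⟦_⟧ S (G x) f +ℤ_) (⟦concatMap⟧ G xs f))

  ⟦graft⟧ : ∀ x (R : Lin S) f → ⟦_⟧ S (_∘₁_ S ((1ℤ , x) ∷ []) R) f ≡ ⟦_⟧ S R (f ∘ graftCT S x)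
  ⟦graft⟧ x []            f = refl
  ⟦graft⟧ x ((k , y) ∷ R) f =
    cong₂ _+ℤ_ (cong (_*ℤ f (graftCT S x y)) (ℤ.*-identityˡ k)) (⟦graft⟧ x R f)

  ⟦Mt⟧ : ∀ μ t cols f → ⟦_⟧ S (Mt μ t cols) f ≡ ∑ (PBT (leaves t)) (λ w → μ w t *ℤ f (w , cols))
  ⟦Mt⟧ μ t cols f = go (PBT (leaves t))
    where
    go : ∀ ws → ⟦_⟧ S (map (λ w → (μ w t , (w , cols))) ws) f ≡ ∑ ws (λ w → μ w t *ℤ f (w , cols))
    go []       = refl
    go (w ∷ ws) = cong (μ w t *ℤ f (w , cols) +ℤ_) (go ws)

  Mt-uniqueLowerCover : ∀ dec μ → IsMobius dec μ → UniqueLowerCover c t → ∀ cols →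
                        _≋_ S (Mt μ t cols) ((1ℤ , (t , cols)) ∷ (- 1ℤ , (c , cols)) ∷ [])
  Mt-uniqueLowerCover {c} {t} dec μ isMobius cover cols f = begin
      ⟦_⟧ S (Mt μ t cols) f
    ≡⟨ ⟦Mt⟧ μ t cols f ⟩
      ∑ (PBT (leaves t)) (λ w → μ w t *ℤ g w)
    ≡⟨ ∑-cong-All (All.map (λ {w} → cong (_*ℤ g w) ∘ μ-uniqueLowerCover dec μ isMobius cover w) (PBT-leaves (leaves t))) ⟩
      ∑ (PBT (leaves t)) (λ w → (δ w t -ℤ δ w c) *ℤ g w)
    ≡⟨ ∑-cong (PBT (leaves t)) (λ w → [y-z]x≈yx-zx (g w) (δ w t) (δ w c)) ⟩
      ∑ (PBT (leaves t)) (λ w → δ w t *ℤ g w -ℤ δ w c *ℤ g w)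
    ≡⟨ ∑-− (PBT (leaves t)) ⟩
      ∑ (PBT (leaves t)) (λ w → δ w t *ℤ g w) -ℤ ∑ (PBT (leaves t)) (λ w → δ w c *ℤ g w)
    ≡⟨ cong₂ _-ℤ_ (PBT-δ g refl) (PBT-δ g (≤T-leaves (UniqueLowerCover.c≤t cover))) ⟩
      g t -ℤ g c
    ≡⟨ ⟦difference⟧ (t , cols) (c , cols) f ⟨
      ⟦_⟧ S ((1ℤ , (t , cols)) ∷ (- 1ℤ , (c , cols)) ∷ []) f
    ∎
    where
    g : Tree → ℤ
    g w = f (w , cols)

-- The expansion

replicate-++ : ∀ {A : Set} m n (x : A) → replicate m x ++ replicate n x ≡ replicate (m + n) x
replicate-++ zero    n x = refl
replicate-++ (suc m) n x = cong (x ∷_) (replicate-++ m n x)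

+-∸-cancelˡ : ∀ k j m → k + (j + m) ∸ j ≡ k + m
+-∸-cancelˡ k j m = trans (ℕ.+-∸-assoc k (ℕ.m≤m+n j m)) (cong (k +_) (ℕ.m+n∸m≡n j m))

module Expansion {S : Set} (μ : Tree → Tree → ℤ) (s• s : S) (f : CT S → ℤ) where

  coloredComb : ℕ → CT S
  coloredComb j = (O (suc j) , replicate j s•)

  -- For n = p + 1, summand p j is the (j+1)-th summand of the right-hand side.
  summand : ℕ → ℕ → Lin S
  summand p j = _∘₁_ S ((1ℤ , coloredComb j) ∷ []) (Mk μ s• s (suc (suc p) ∸ j))

  term : ℕ → ℕ → ℤ
  term p j = ⟦_⟧ S (summand p j) f

  grafted : ℕ → ℕ → ℤ
  grafted p j = f (graft1 (O (suc j)) (node leaf (O (suc p ∸ j))) , s ∷ replicate p s•)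

  term-Mk : ∀ {p j n} → suc (suc p) ∸ j ≡ n → term p j ≡ ⟦_⟧ S (Mk μ s• s n) (f ∘ graftCT S (coloredComb j))
  term-Mk {p} {j} refl = ⟦graft⟧ (coloredComb j) (Mk μ s• s (suc (suc p) ∸ j)) f

  term≡difference : ∀ dec → IsMobius dec μ → ∀ {p j} → j < p → term p j ≡ grafted p j -ℤ grafted p (suc j)
  term≡difference dec isMobius {j = j} j<p with ℕ.m≤n⇒∃[o]m+o≡n j<p
  ... | k , refl = begin
      term p j
    ≡⟨ term-Mk (+-∸-cancelˡ 3 j k) ⟩
      ⟦_⟧ S (Mt μ T cols) (f ∘ graftCT S (coloredComb j))
    ≡⟨ Mt-uniqueLowerCover dec μ isMobius (leftComb-rotation-cover leaf (O-isLeftComb (suc k))) cols _ ⟩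
      ⟦_⟧ S ((1ℤ , (T , cols)) ∷ (- 1ℤ , (C , cols)) ∷ []) (f ∘ graftCT S (coloredComb j))
    ≡⟨ ⟦difference⟧ (T , cols) (C , cols) (f ∘ graftCT S (coloredComb j)) ⟩
      f (graft1 (O (suc j)) T , cols ++ replicate j s•) -ℤ f (graft1 (O (suc j)) C , cols ++ replicate j s•)
    ≡⟨ cong₂ _-ℤ_ (cong₂ (λ n cs → f (graft1 (O (suc j)) (node leaf (O n)) , cs)) (sym (+-∸-cancelˡ 2 j k)) colors)
                  (cong₂ (λ t cs → f (t , cs))
                         (trans (graft-O j (node leaf (O (suc k))))
                                (cong (λ n → graft1 (O (suc (suc j))) (node leaf (O n))) (sym (+-∸-cancelˡ 1 j k))))
                         colors) ⟩
      grafted p j -ℤ grafted p (suc j)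
    ∎
    where
    p : ℕ
    p = suc (j + k)
    T C : Tree
    T = node leaf (O (suc (suc k)))
    C = node (node leaf (O (suc k))) leaf
    cols : List S
    cols = s ∷ replicate (suc k) s•
    colors : cols ++ replicate j s• ≡ s ∷ replicate p s•
    colors = cong (s ∷_) (trans (replicate-++ (suc k) j s•) (cong (λ n → replicate (suc n) s•) (ℕ.+-comm k j)))

  term-last-two : ∀ p → term p p +ℤ term p (suc p) ≡ grafted p p
  term-last-two p = begin
      term p p +ℤ term p (suc p)
    ≡⟨ cong₂ _+ℤ_ (term-Mk (ℕ.m+n∸n≡m 2 p)) (term-Mk (ℕ.m+n∸n≡m 1 p)) ⟩
      ⟦_⟧ S (Mk μ s• s 2) (f ∘ graftCT S (coloredComb p)) +ℤ ⟦_⟧ S (Mk μ s• s 1) (f ∘ graftCT S (coloredComb (suc p)))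
    ≡⟨ cong₂ _+ℤ_ (⟦difference⟧ (node leaf leaf , s ∷ []) (node leaf leaf , s• ∷ []) (f ∘ graftCT S (coloredComb p)))
                  (trans (⟦singleton⟧ (leaf , []) (f ∘ graftCT S (coloredComb (suc p))))
                         (cong (λ t → f (t , replicate (suc p) s•)) (sym (graft-O p leaf)))) ⟩
      (A -ℤ B) +ℤ B
    ≡⟨ cancel A B ⟩
      A
    ≡⟨ cong (λ n → f (graft1 (O (suc p)) (node leaf (O n)) , s ∷ replicate p s•)) (sym (ℕ.m+n∸n≡m 1 p)) ⟩
      grafted p p
    ∎
    where
    A B : ℤ
    A = f (graft1 (O (suc p)) (node leaf leaf) , s ∷ replicate p s•)
    B = f (graft1 (O (suc p)) (node leaf leaf) , s• ∷ replicate p s•)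
    cancel : ∀ x y → (x -ℤ y) +ℤ y ≡ x
    cancel = solve-∀

-- The identity holds for every color s.
lemma3p10 : (S : Set) (s• s : S) → s ≢ s• → (n : ℕ) → 1 ≤ n →
    (dec : Decidable _≤T_) (μ : Tree → Tree → ℤ) → IsMobius dec μ →
    _≋_ S (LHS s• s n) (RHS μ s• s n)
lemma3p10 S s• s _ (suc p) _ dec μ isMobius f = begin
    ⟦_⟧ S (LHS s• s (suc p)) f
  ≡⟨ ⟦singleton⟧ _ f ⟩
    grafted p 0
  ≡⟨ telescope p (term p) (grafted p) (term≡difference dec isMobius) (term-last-two p) ⟨
    ∑ (upTo (2 + p)) (term p)
  ≡⟨ ⟦concatMap⟧ (summand p) (upTo (2 + p)) f ⟨
    ⟦_⟧ S (RHS μ s• s (suc p)) f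
  ∎
  where
  open Expansion μ s• s f
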